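{- For $n\ge1$ and $p\in\{\pm1,\dots,\pm n\}$, let $b(n,p)$ be the number of type-$B$ snakes of size $n$, i.e. signed permutations $\pi$ of size $n$ with $0>\pi_1<\pi_2>\pi_3<\pi_4>\cdots$, whose last letter is $\pi_n=p$. Then $b(1,-1)=1$, $b(1,1)=0$, and for $n\ge2$: if $n$ is even, $b(n,p)=\sum_{q\le p}b(n-1,q)$ for $p<0$ and $b(n,p)=\sum_{q<p}b(n-1,q)$ for $p>0$; if $n$ is odd, $b(n,p)=\sum_{q\ge p}b(n-1,q)$ for $p>0$ and $b(n,p)=\sum_{q>p}b(n-1,q)$ for $p<0$; where in each sum $q$ ranges over $\{\pm1,\dots,\pm(n-1)\}$.
   Context: A signed permutation of size $n$ is a word $\pi=\pi_1\cdots\pi_n$ over the nonzero integers such that $|\pi_1|,\dots,|\pi_n|$ is a permutation of $\{1,\dots,n\}$; letters are compared as integers. -}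

module Defs where

open import Data.Nat as ℕ using (ℕ; zero; suc)
open import Data.Integer as ℤ using (ℤ; +_; -[1+_]; ∣_∣; _<_; _>_; _≤_)
open import Data.Integer.Properties using (_<?_; _≤?_)
import Data.Nat.Properties as ℕP
open import Data.Nat.ListAction using (sum)
open import Data.List using (List; []; _∷_; map; filter; length; concatMap; upTo; _++_; last)
open import Data.List.Relation.Unary.All using (All; all?)
open import Data.List.Relation.Unary.Unique.Propositional using (Unique)
open import Data.List.Relation.Unary.Unique.DecPropositional ℕP._≟_ using (unique?)
open import Data.Maybe using (Maybe; just; nothing)
open import Data.Maybe.Properties using (≡-dec)
open import Data.Product using (_×_; _,_; proj₁; proj₂)
open import Data.Unit using (⊤; tt)
open import Relation.Nullary using (Dec; yes; no; ¬_)
open import Relation.Nullary.Decidable using (_×-dec_)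
open import Relation.Binary.PropositionalEquality using (_≡_)
import Data.Integer.Properties as ℤP

letters : ℕ → List ℤ
letters n = map (λ k → + suc k) (upTo n) ++ map (λ k → -[1+ k ]) (upTo n)

words : ℕ → ℕ → List (List ℤ)
words n zero    = [] ∷ []
words n (suc k) = concatMap (λ w → map (_∷ w) (letters n)) (words n k)

InRange : ℕ → ℤ → Set
InRange n x = (1 ℕ.≤ ∣ x ∣) × (∣ x ∣ ℕ.≤ n)

SignedPerm : ℕ → List ℤ → Set
SignedPerm n w = (length w ≡ n) × All (InRange n) w × Unique (map ∣_∣ w)

Up Down : List ℤ → Set
Up []           = ⊤
Up (x ∷ [])     = ⊤
Up (x ∷ y ∷ ys) = (x < y) × Down (y ∷ ys)
Down []           = ⊤
Down (x ∷ [])     = ⊤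
Down (x ∷ y ∷ ys) = (x > y) × Up (y ∷ ys)

SnakeShape : List ℤ → Set
SnakeShape []       = ⊤
SnakeShape (x ∷ xs) = (x < + 0) × Up (x ∷ xs)

SnakeEndingAt : ℕ → ℤ → List ℤ → Set
SnakeEndingAt n p w = SignedPerm n w × SnakeShape w × (last w ≡ just p)

inRange? : ∀ n x → Dec (InRange n x)
inRange? n x = (1 ℕP.≤? ∣ x ∣) ×-dec (∣ x ∣ ℕP.≤? n)

up? : ∀ w → Dec (Up w)
down? : ∀ w → Dec (Down w)
up? []           = yes tt
up? (x ∷ [])     = yes tt
up? (x ∷ y ∷ ys) = (x <? y) ×-dec down? (y ∷ ys)
down? []           = yes tt
down? (x ∷ [])     = yes tt
down? (x ∷ y ∷ ys) = (y <? x) ×-dec up? (y ∷ ys)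

snakeShape? : ∀ w → Dec (SnakeShape w)
snakeShape? []       = yes tt
snakeShape? (x ∷ xs) = (x <? + 0) ×-dec up? (x ∷ xs)

snakeEndingAt? : ∀ n p w → Dec (SnakeEndingAt n p w)
snakeEndingAt? n p w =
  ((length w ℕP.≟ n) ×-dec (all? (inRange? n) w ×-dec unique? (map ∣_∣ w)))
  ×-dec (snakeShape? w ×-dec ≡-dec ℤP._≟_ (last w) (just p))

-- b(n,p): the number of type-B snakes of size n with last letter p.
-- Every signed permutation of size n is a word of length n over  letters n,
-- so counting inside  words n n  counts all of them (each exactly once).
b : ℕ → ℤ → ℕ
b n p = length (filter (snakeEndingAt? n p) (words n n))

sumOver : ∀ {P : ℤ → Set} → ((q : ℤ) → Dec (P q)) → ℕ → (ℤ → ℕ) → ℕ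
sumOver P? m f = sum (map f (filter P? (letters m)))

-- Removing the last letter p of a type-B snake of size n and closing the gap it leaves (every
-- letter of absolute value > |p| moves one step towards 0, keeping its sign) gives a type-B snake
-- of size n - 1.  This is a bijection onto those snakes of size n - 1 whose last letter q, once the
-- gap is re-opened, compares with p as the snake pattern demands at position n - 1: an ascent if
-- n is even, a descent if n is odd.  Re-opening the gap moves no letter across p, so the condition
-- is q < p, q <= p, q >= p or q > p according to the parity of n and the sign of p.  Summing the
-- number of snakes of size n - 1 over their last letter q then gives the recurrence.
module Submission where

open import Defs
open import Data.Nat using (ℕ; _∸_; _%_)
open import Data.Integer using (ℤ; +_; -_; ∣_∣; _<_; _>_; _≤_; _≥_)
open import Data.Integer.Properties using (_<?_; _≤?_)
open import Data.Product using (_×_)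
open import Relation.Binary.PropositionalEquality using (_≡_)
import Data.Nat as ℕ

open import Level using (0ℓ)
open import Data.Bool using (Bool; true; false; not)
open import Data.Empty using (⊥; ⊥-elim)
open import Data.Nat using (zero; suc; z≤n; s≤s; z<s; s<s)
import Data.Nat.Properties as ℕP
import Data.Integer.Properties as ℤP
open import Data.Nat.ListAction using (sum)
open import Data.Integer using (-[1+_]; -<-; -<+; +<+; -≤-; +≤+)
open import Data.List
  using (List; []; _∷_; map; length; filter; last; upTo; _++_; _∷ʳ_; concatMap; cartesianProductWith; initLast; _∷ʳ′_)
open import Data.List.Properties
  using (length-map; filter-none; filter-≐; map-++; map-∘; map-id-local; map-injective; ∷ʳ-injectiveˡ)
open import Data.List.Relation.Unary.All as All using (All; []; _∷_)
import Data.List.Relation.Unary.All.Properties as All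
import Data.List.Relation.Unary.AllPairs as AllPairs
open import Data.List.Relation.Unary.Any as Any using (Any; here; any?)
open import Data.List.Relation.Unary.Unique.Propositional using (Unique)
import Data.List.Relation.Unary.Unique.Propositional.Properties as Unique
open import Data.List.Membership.Propositional using (_∈_; find; lose)
open import Data.List.Membership.Propositional.Properties
  using (∈-map⁺; ∈-map⁻; ∈-filter⁺; ∈-filter⁻; ∈-++⁺ˡ; ∈-++⁺ʳ; ∈-upTo⁺; ∈-cartesianProductWith⁺)
open import Data.List.Membership.Propositional.Properties.WithK using (unique∧set⇒bag)
open import Data.List.Relation.Binary.BagAndSetEquality using (∼bag⇒↭)
open import Data.List.Relation.Binary.Permutation.Propositional.Properties using (↭-length)
open import Data.Maybe as Maybe using (just)
open import Data.Maybe.Properties using (just-injective)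
open import Data.Product using (_,_; proj₁; proj₂; ∃)
open import Data.Unit using (⊤; tt)
open import Function.Base using (_∘′_)
open import Function.Bundles using (_⇔_; mk⇔; Equivalence)
open import Function.Definitions using (Injective)
open import Relation.Binary.PropositionalEquality using (_≢_; refl; sym; trans; cong; cong₂; subst; subst₂; module ≡-Reasoning)
open import Relation.Nullary using (yes; no)
open import Relation.Unary using (Pred; Decidable)
open import Relation.Unary.Properties using (_∪?_)

-- The ℕ analogues of Data.Fin.punchIn/punchOut: punchIn t skips the value t, punchOut t closes
-- the gap (and sends t to t).
punchIn : ℕ → ℕ → ℕ
punchIn zero    i       = suc i
punchIn (suc t) zero    = zero
punchIn (suc t) (suc i) = suc (punchIn t i)

punchOut : ℕ → ℕ → ℕ
punchOut zero    zero    = zero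
punchOut zero    (suc i) = i
punchOut (suc t) zero    = zero
punchOut (suc t) (suc i) = suc (punchOut t i)

punchIn-≢ : ∀ t i → punchIn t i ≢ t
punchIn-≢ (suc t) (suc i) e = punchIn-≢ t i (ℕP.suc-injective e)

punchOut-punchIn : ∀ t i → punchOut t (punchIn t i) ≡ i
punchOut-punchIn zero    i       = refl
punchOut-punchIn (suc t) zero    = refl
punchOut-punchIn (suc t) (suc i) = cong suc (punchOut-punchIn t i)

punchIn-punchOut : ∀ {t i} → i ≢ t → punchIn t (punchOut t i) ≡ i
punchIn-punchOut {zero}  {zero}  i≢t = ⊥-elim (i≢t refl)
punchIn-punchOut {zero}  {suc i} _   = refl
punchIn-punchOut {suc t} {zero}  _   = refl
punchIn-punchOut {suc t} {suc i} i≢t = cong suc (punchIn-punchOut (i≢t ∘′ cong suc))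

punchIn-injective : ∀ t → Injective _≡_ _≡_ (punchIn t)
punchIn-injective t {i} {i′} e =
  trans (sym (punchOut-punchIn t i)) (trans (cong (punchOut t) e) (punchOut-punchIn t i′))

punchIn-mono-< : ∀ t {i i′} → i ℕ.< i′ → punchIn t i ℕ.< punchIn t i′
punchIn-mono-< zero    i<i′                     = s<s i<i′
punchIn-mono-< (suc t) {zero}  {suc i′} _       = z<s
punchIn-mono-< (suc t) {suc i} {suc i′} (s<s l) = s<s (punchIn-mono-< t l)

punchIn-cancel-< : ∀ t {i i′} → punchIn t i ℕ.< punchIn t i′ → i ℕ.< i′
punchIn-cancel-< zero    (s<s l)                  = l
punchIn-cancel-< (suc t) {zero}  {suc i′} _       = z<s
punchIn-cancel-< (suc t) {suc i} {suc i′} (s<s l) = s<s (punchIn-cancel-< t l)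

≤⇒<punchIn : ∀ t {i} → t ℕ.≤ i → t ℕ.< punchIn t i
≤⇒<punchIn zero    _       = z<s
≤⇒<punchIn (suc t) (s≤s l) = s<s (≤⇒<punchIn t l)

<punchIn⇒≤ : ∀ t {i} → t ℕ.< punchIn t i → t ℕ.≤ i
<punchIn⇒≤ zero    _                 = z≤n
<punchIn⇒≤ (suc t) {suc i} (s<s l) = s≤s (<punchIn⇒≤ t l)

<⇒punchIn< : ∀ t {i} → i ℕ.< t → punchIn t i ℕ.< t
<⇒punchIn< (suc t) {zero}  _       = z<s
<⇒punchIn< (suc t) {suc i} (s<s l) = s<s (<⇒punchIn< t l)

punchIn<⇒< : ∀ t {i} → punchIn t i ℕ.< t → i ℕ.< t
punchIn<⇒< (suc t) {zero}  _       = z<s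
punchIn<⇒< (suc t) {suc i} (s<s l) = s<s (punchIn<⇒< t l)

≤punchIn : ∀ t i → i ℕ.≤ punchIn t i
≤punchIn zero    i       = ℕP.n≤1+n i
≤punchIn (suc t) zero    = z≤n
≤punchIn (suc t) (suc i) = s≤s (≤punchIn t i)

punchIn≤suc : ∀ t i → punchIn t i ℕ.≤ suc i
punchIn≤suc zero    i       = ℕP.≤-refl
punchIn≤suc (suc t) zero    = z≤n
punchIn≤suc (suc t) (suc i) = s≤s (punchIn≤suc t i)

punchOut-positive : ∀ t {i} → 1 ℕ.≤ i → 1 ℕ.≤ punchOut (suc t) i
punchOut-positive t {suc i} _ = s≤s z≤n

punchOut-≤ : ∀ {t i n} → i ≢ t → t ℕ.≤ suc n → i ℕ.≤ suc n → punchOut t i ℕ.≤ n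
punchOut-≤ {zero}  {zero}          i≢t _         _           = ⊥-elim (i≢t refl)
punchOut-≤ {zero}  {suc i}         _   _         (s≤s i≤n)   = i≤n
punchOut-≤ {suc t} {zero}          _   _         _           = z≤n
punchOut-≤ {suc t} {suc i} {zero}  i≢t (s≤s z≤n) (s≤s z≤n)   = ⊥-elim (i≢t refl)
punchOut-≤ {suc t} {suc i} {suc n} i≢t (s≤s t≤n) (s≤s i≤n) =
  s≤s (punchOut-≤ (λ e → i≢t (cong suc e)) t≤n i≤n)

-- punchIn± j moves every letter of absolute value ≥ j + 1 one step away from 0, freeing ±(j + 1).
punchIn± : ℕ → ℤ → ℤ
punchIn± j (+ i)    = + punchIn (suc j) i
punchIn± j -[1+ i ] = -[1+ punchIn j i ]

punchOut± : ℕ → ℤ → ℤ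
punchOut± j (+ i)    = + punchOut (suc j) i
punchOut± j -[1+ i ] = -[1+ punchOut j i ]

∣punchIn±∣ : ∀ j x → ∣ punchIn± j x ∣ ≡ punchIn (suc j) ∣ x ∣
∣punchIn±∣ j (+ i)    = refl
∣punchIn±∣ j -[1+ i ] = refl

∣punchOut±∣ : ∀ j x → ∣ punchOut± j x ∣ ≡ punchOut (suc j) ∣ x ∣
∣punchOut±∣ j (+ i)    = refl
∣punchOut±∣ j -[1+ i ] = refl

punchOut±-punchIn± : ∀ j x → punchOut± j (punchIn± j x) ≡ x
punchOut±-punchIn± j (+ i)    = cong +_ (punchOut-punchIn (suc j) i)
punchOut±-punchIn± j -[1+ i ] = cong -[1+_] (punchOut-punchIn j i)

punchIn±-punchOut± : ∀ j {x} → ∣ x ∣ ≢ suc j → punchIn± j (punchOut± j x) ≡ x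
punchIn±-punchOut± j {+ i}      x≢j = cong +_ (punchIn-punchOut x≢j)
punchIn±-punchOut± j { -[1+ i ] } x≢j = cong -[1+_] (punchIn-punchOut (λ e → x≢j (cong suc e)))

punchIn±-injective : ∀ j → Injective _≡_ _≡_ (punchIn± j)
punchIn±-injective j {x} {y} e =
  trans (sym (punchOut±-punchIn± j x)) (trans (cong (punchOut± j) e) (punchOut±-punchIn± j y))

punchIn±-mono-< : ∀ j {x y} → x < y → punchIn± j x < punchIn± j y
punchIn±-mono-< j (-<- l) = -<- (punchIn-mono-< j l)
punchIn±-mono-< j -<+     = -<+
punchIn±-mono-< j (+<+ l) = +<+ (punchIn-mono-< (suc j) l)

punchIn±-cancel-< : ∀ j {x y} → punchIn± j x < punchIn± j y → x < y
punchIn±-cancel-< j { -[1+ _ ] } { -[1+ _ ] } (-<- l) = -<- (punchIn-cancel-< j l)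
punchIn±-cancel-< j { -[1+ _ ] } {+ _}        _       = -<+
punchIn±-cancel-< j {+ _}        {+ _}        (+<+ l) = +<+ (punchIn-cancel-< (suc j) l)

punchOut±-mono-< : ∀ j {x y} → ∣ x ∣ ≢ suc j → ∣ y ∣ ≢ suc j → x < y → punchOut± j x < punchOut± j y
punchOut±-mono-< j x≢j y≢j x<y = punchIn±-cancel-< j
  (subst₂ _<_ (sym (punchIn±-punchOut± j x≢j)) (sym (punchIn±-punchOut± j y≢j)) x<y)

punchIn±-negative : ∀ j {x} → x < + 0 → punchIn± j x < + 0
punchIn±-negative j { -[1+ _ ] } _ = -<+
punchIn±-negative j {+ _}        (+<+ ())

punchOut±-negative : ∀ j {x} → x < + 0 → punchOut± j x < + 0
punchOut±-negative j { -[1+ _ ] } _ = -<+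
punchOut±-negative j {+ _}        (+<+ ())

punchIn±-inRange : ∀ j {n x} → InRange n x → InRange (suc n) (punchIn± j x)
punchIn±-inRange j {n} {x} (1≤x , x≤n) rewrite ∣punchIn±∣ j x =
  ℕP.≤-trans 1≤x (≤punchIn (suc j) ∣ x ∣) , ℕP.≤-trans (punchIn≤suc (suc j) ∣ x ∣) (s≤s x≤n)

punchOut±-inRange : ∀ j {n x} → suc j ℕ.≤ suc n → ∣ x ∣ ≢ suc j → InRange (suc n) x → InRange n (punchOut± j x)
punchOut±-inRange j {n} {x} j≤n x≢j (1≤x , x≤n) rewrite ∣punchOut±∣ j x =
  punchOut-positive j 1≤x , punchOut-≤ x≢j j≤n x≤n

-- Re-opening the gap at |p| moves no letter across p: the four conditions on the last letter.
<-punchIn±-pos : ∀ j q → q < + suc j ⇔ punchIn± j q < + suc j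
<-punchIn±-pos j q = mk⇔ to from
  where
  to : ∀ {q} → q < + suc j → punchIn± j q < + suc j
  to { -[1+ _ ] } _       = -<+
  to {+ _}        (+<+ l) = +<+ (<⇒punchIn< (suc j) l)
  from : ∀ {q} → punchIn± j q < + suc j → q < + suc j
  from { -[1+ _ ] } _       = -<+
  from {+ _}        (+<+ l) = +<+ (punchIn<⇒< (suc j) l)

≤-punchIn±-pos : ∀ j q → + suc j ≤ q ⇔ + suc j < punchIn± j q
≤-punchIn±-pos j q = mk⇔ to from
  where
  to : ∀ {q} → + suc j ≤ q → + suc j < punchIn± j q
  to {+ _} (+≤+ l) = +<+ (≤⇒<punchIn (suc j) l)
  from : ∀ {q} → + suc j < punchIn± j q → + suc j ≤ q
  from {+ _} (+<+ l) = +≤+ (<punchIn⇒≤ (suc j) l)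

≤-punchIn±-neg : ∀ j q → q ≤ -[1+ j ] ⇔ punchIn± j q < -[1+ j ]
≤-punchIn±-neg j q = mk⇔ to from
  where
  to : ∀ {q} → q ≤ -[1+ j ] → punchIn± j q < -[1+ j ]
  to { -[1+ _ ] } (-≤- l) = -<- (≤⇒<punchIn j l)
  from : ∀ {q} → punchIn± j q < -[1+ j ] → q ≤ -[1+ j ]
  from { -[1+ _ ] } (-<- l) = -≤- (<punchIn⇒≤ j l)

<-punchIn±-neg : ∀ j q → -[1+ j ] < q ⇔ -[1+ j ] < punchIn± j q
<-punchIn±-neg j q = mk⇔ to from
  where
  to : ∀ {q} → -[1+ j ] < q → -[1+ j ] < punchIn± j q
  to {+ _}        _       = -<+
  to { -[1+ _ ] } (-<- l) = -<- (<⇒punchIn< j l)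
  from : ∀ {q} → -[1+ j ] < punchIn± j q → -[1+ j ] < q
  from {+ _}        _       = -<+
  from { -[1+ _ ] } (-<- l) = -<- (punchIn<⇒< j l)

module _ {A : Set} {P Q : Pred A 0ℓ} (P? : Decidable P) (Q? : Decidable Q) where

  length-filter-∪ : (∀ {x} → P x → Q x → ⊥) → ∀ xs →
    length (filter (P? ∪? Q?) xs) ≡ length (filter P? xs) ℕ.+ length (filter Q? xs)
  length-filter-∪ disjoint [] = refl
  length-filter-∪ disjoint (x ∷ xs) with P? x | Q? x
  ... | yes px | yes qx = ⊥-elim (disjoint px qx)
  ... | yes px | no ¬qx  = cong suc (length-filter-∪ disjoint xs)
  ... | no ¬px | yes qx  = trans (cong suc (length-filter-∪ disjoint xs)) (sym (ℕP.+-suc _ _))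
  ... | no ¬px | no ¬qx = length-filter-∪ disjoint xs

module _ {A B : Set} {P : B → Pred A 0ℓ} (P? : ∀ q → Decidable (P q))
         (fibres-disjoint : ∀ {q q′ x} → P q x → P q′ x → q ≡ q′) where

  sum-length-filter-fibres : ∀ {qs} → Unique qs → ∀ xs →
    sum (map (λ q → length (filter (P? q) xs)) qs) ≡
    length (filter (λ x → any? (λ q → P? q x) qs) xs)
  sum-length-filter-fibres {[]} AllPairs.[] xs =
    sym (cong length (filter-none (λ x → any? (λ q → P? q x) []) (All.universal (λ _ ()) xs)))
  sum-length-filter-fibres {q ∷ qs} (q∉qs AllPairs.∷ uqs) xs = begin
    length (filter (P? q) xs) ℕ.+ sum (map (λ q → length (filter (P? q) xs)) qs)
      ≡⟨ cong (length (filter (P? q) xs) ℕ.+_) (sum-length-filter-fibres uqs xs) ⟩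
    length (filter (P? q) xs) ℕ.+ length (filter Any? xs)
      ≡⟨ sym (length-filter-∪ (P? q) Any? disjoint xs) ⟩
    length (filter (P? q ∪? Any?) xs)
      ≡⟨ cong length (filter-≐ (P? q ∪? Any?) (λ x → any? (λ q → P? q x) (q ∷ qs))
                       (Any.fromSum , Any.toSum) xs) ⟩
    length (filter (λ x → any? (λ q → P? q x) (q ∷ qs)) xs) ∎
    where
    open ≡-Reasoning
    Any? : Decidable (λ x → Any (λ q → P q x) qs)
    Any? x = any? (λ q → P? q x) qs
    disjoint : ∀ {x} → P q x → Any (λ q → P q x) qs → ⊥
    disjoint pqx any with find any
    ... | q′ , q′∈qs , pq′x = All.lookup q∉qs q′∈qs (fibres-disjoint pqx pq′x)

length-filter-bijection :
  ∀ {A B : Set} {P : Pred A 0ℓ} {Q : Pred B 0ℓ} (P? : Decidable P) (Q? : Decidable Q)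
    {xs : List A} {ys : List B} {f : A → B} → Injective _≡_ _≡_ f →
  Unique xs → Unique ys → (∀ {x} → P x → x ∈ xs) → (∀ {y} → Q y → y ∈ ys) →
  (∀ {x} → P x → Q (f x)) → (∀ {y} → Q y → ∃ λ x → P x × f x ≡ y) →
  length (filter P? xs) ≡ length (filter Q? ys)
length-filter-bijection P? Q? {xs} {ys} {f} f-inj uxs uys P⊆xs Q⊆ys f-P⇒Q f-onto =
  trans (sym (length-map f (filter P? xs)))
        (↭-length (∼bag⇒↭ (unique∧set⇒bag (Unique.map⁺ f-inj (Unique.filter⁺ P? uxs))
                                          (Unique.filter⁺ Q? uys) (mk⇔ to from))))
  where
  to : ∀ {y} → y ∈ map f (filter P? xs) → y ∈ filter Q? ys
  to y∈ with ∈-map⁻ f y∈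
  ... | x , x∈ , refl with ∈-filter⁻ P? {xs = xs} x∈
  ... | _ , px = ∈-filter⁺ Q? (Q⊆ys (f-P⇒Q px)) (f-P⇒Q px)
  from : ∀ {y} → y ∈ filter Q? ys → y ∈ map f (filter P? xs)
  from y∈ with ∈-filter⁻ Q? {xs = ys} y∈
  ... | _ , qy with f-onto qy
  ... | x , px , refl = ∈-map⁺ f (∈-filter⁺ P? (P⊆xs px) px)

∈-letters : ∀ {n x} → InRange n x → x ∈ letters n
∈-letters {n} {+ suc i}    (_ , i<n) = ∈-++⁺ˡ (∈-map⁺ (λ k → + suc k) (∈-upTo⁺ i<n))
∈-letters {n} { -[1+ i ] } (_ , i<n) = ∈-++⁺ʳ _ (∈-map⁺ -[1+_] (∈-upTo⁺ i<n))

letters-unique : ∀ n → Unique (letters n)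
letters-unique n = Unique.++⁺ (Unique.map⁺ (ℕP.suc-injective ∘′ ℤP.+-injective) (Unique.upTo⁺ n))
                              (Unique.map⁺ ℤP.-[1+-injective (Unique.upTo⁺ n)) disjoint
  where
  disjoint : ∀ {x} → x ∈ map (λ k → + suc k) (upTo n) × x ∈ map -[1+_] (upTo n) → ⊥
  disjoint (x∈pos , x∈neg) with ∈-map⁻ _ x∈pos | ∈-map⁻ _ x∈neg
  ... | _ , _ , refl | _ , _ , ()

words-suc : ∀ n k → words n (suc k) ≡ cartesianProductWith (λ w x → x ∷ w) (words n k) (letters n)
words-suc n k = concatMap-cartesian (words n k)
  where
  concatMap-cartesian : ∀ ws → concatMap (λ w → map (_∷ w) (letters n)) ws ≡ cartesianProductWith (λ w x → x ∷ w) ws (letters n)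
  concatMap-cartesian []       = refl
  concatMap-cartesian (w ∷ ws) = cong (map (_∷ w) (letters n) ++_) (concatMap-cartesian ws)

∈-words : ∀ {n w} → All (InRange n) w → w ∈ words n (length w)
∈-words {n} {[]}    []           = here refl
∈-words {n} {x ∷ w} (x∈ ∷ w∈) rewrite words-suc n (length w) =
  ∈-cartesianProductWith⁺ (λ w x → x ∷ w) (∈-words w∈) (∈-letters x∈)

words-unique : ∀ n k → Unique (words n k)
words-unique n zero    = [] AllPairs.∷ AllPairs.[]
words-unique n (suc k) rewrite words-suc n k =
  Unique.cartesianProductWith⁺ (λ w x → x ∷ w) swap-∷-injective (words-unique n k) (letters-unique n)
  where
  swap-∷-injective : ∀ {w w′ x x′} → x ∷ w ≡ x′ ∷ w′ → w ≡ w′ × x ≡ x′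
  swap-∷-injective refl = refl , refl

∈-words-signedPerm : ∀ {n w} → SignedPerm n w → w ∈ words n n
∈-words-signedPerm (refl , w-range , _) = ∈-words w-range

Alternating : Bool → List ℤ → Set
Alternating true  = Up
Alternating false = Down

Step : Bool → ℤ → ℤ → Set
Step true  a c = a < c
Step false a c = a > c

flips : ℕ → Bool → Bool
flips zero    b = b
flips (suc k) b = flips k (not b)

alternating-∷ʳ⁺ : ∀ b x xs {q p} → last (x ∷ xs) ≡ just q →
  Alternating b (x ∷ xs) → Step (flips (length xs) b) q p → Alternating b ((x ∷ xs) ∷ʳ p)
alternating-∷ʳ⁺ true  x []       refl _       s = s , tt
alternating-∷ʳ⁺ false x []       refl _       s = s , tt
alternating-∷ʳ⁺ true  x (y ∷ ys) lq   (s , a) t = s , alternating-∷ʳ⁺ false y ys lq a t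
alternating-∷ʳ⁺ false x (y ∷ ys) lq   (s , a) t = s , alternating-∷ʳ⁺ true  y ys lq a t

alternating-∷ʳ⁻ : ∀ b x xs {q p} → last (x ∷ xs) ≡ just q →
  Alternating b ((x ∷ xs) ∷ʳ p) → Alternating b (x ∷ xs) × Step (flips (length xs) b) q p
alternating-∷ʳ⁻ true  x []       refl (s , _) = tt , s
alternating-∷ʳ⁻ false x []       refl (s , _) = tt , s
alternating-∷ʳ⁻ true  x (y ∷ ys) lq   (s , a) with alternating-∷ʳ⁻ false y ys lq a
... | a′ , t = (s , a′) , t
alternating-∷ʳ⁻ false x (y ∷ ys) lq   (s , a) with alternating-∷ʳ⁻ true y ys lq a
... | a′ , t = (s , a′) , t

alternating-map : ∀ {Q : ℤ → Set} {f : ℤ → ℤ} → (∀ {a c} → Q a → Q c → a < c → f a < f c) →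
  ∀ b {xs} → All Q xs → Alternating b xs → Alternating b (map f xs)
alternating-map mono true  []                 _ = tt
alternating-map mono false []                 _ = tt
alternating-map mono true  (_ ∷ [])           _ = tt
alternating-map mono false (_ ∷ [])           _ = tt
alternating-map mono true  (qx ∷ qy ∷ qs) (s , a) = mono qx qy s , alternating-map mono false (qy ∷ qs) a
alternating-map mono false (qx ∷ qy ∷ qs) (s , a) = mono qy qx s , alternating-map mono true  (qy ∷ qs) a

last-map : ∀ {A B : Set} (f : A → B) xs → last (map f xs) ≡ Maybe.map f (last xs)
last-map f []           = refl
last-map f (x ∷ [])     = refl
last-map f (x ∷ y ∷ ys) = last-map f (y ∷ ys)

length-∷ʳ : ∀ {A : Set} (xs : List A) {p} → length (xs ∷ʳ p) ≡ suc (length xs)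
length-∷ʳ []       = refl
length-∷ʳ (x ∷ xs) = cong suc (length-∷ʳ xs)

last-∷ʳ : ∀ {A : Set} (xs : List A) {p} → last (xs ∷ʳ p) ≡ just p
last-∷ʳ []           = refl
last-∷ʳ (x ∷ [])     = refl
last-∷ʳ (x ∷ y ∷ ys) = last-∷ʳ (y ∷ ys)

last-∷ : ∀ {A : Set} (x : A) xs → ∃ λ q → last (x ∷ xs) ≡ just q
last-∷ x []       = x , refl
last-∷ x (y ∷ ys) = last-∷ y ys

All-last : ∀ {A : Set} {P : A → Set} {xs q} → All P xs → last xs ≡ just q → P q
All-last (px ∷ [])       refl = px
All-last (_ ∷ pys@(_ ∷ _)) lq = All-last pys lq

last⇒∷ʳ : ∀ {A : Set} (w : List A) {p} → last w ≡ just p → ∃ λ v → w ≡ v ∷ʳ p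
last⇒∷ʳ w lw with initLast w
... | v ∷ʳ′ p′ rewrite just-injective (trans (sym (last-∷ʳ v)) lw) = v , refl

∷ʳ-unique⁺ : ∀ {A : Set} {xs : List A} {t} → All (_≢ t) xs → Unique xs → Unique (xs ∷ʳ t)
∷ʳ-unique⁺ []             AllPairs.[]         = [] AllPairs.∷ AllPairs.[]
∷ʳ-unique⁺ (x≢t ∷ xs≢t) (x∉xs AllPairs.∷ u) = All.∷ʳ⁺ x∉xs x≢t AllPairs.∷ ∷ʳ-unique⁺ xs≢t u

∷ʳ-unique⁻ : ∀ {A : Set} (xs : List A) {t} → Unique (xs ∷ʳ t) → All (_≢ t) xs × Unique xs
∷ʳ-unique⁻ []       _                    = [] , AllPairs.[]
∷ʳ-unique⁻ (x ∷ xs) (x∉ AllPairs.∷ u) with ∷ʳ-unique⁻ xs u | All.∷ʳ⁻ x∉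
... | xs≢t , uxs | x∉xs , x≢t = (x≢t ∷ xs≢t) , (x∉xs AllPairs.∷ uxs)

module Punch (j : ℕ) (p : ℤ) (∣p∣≡ : ∣ p ∣ ≡ suc j) where

  map-∣punchIn±∣ : ∀ u → map ∣_∣ (map (punchIn± j) u) ≡ map (punchIn (suc j)) (map ∣_∣ u)
  map-∣punchIn±∣ []       = refl
  map-∣punchIn±∣ (x ∷ xs) = cong₂ _∷_ (∣punchIn±∣ j x) (map-∣punchIn±∣ xs)

  map-punchIn±-punchOut± : ∀ {v} → All (λ y → ∣ y ∣ ≢ suc j) v → map (punchIn± j) (map (punchOut± j) v) ≡ v
  map-punchIn±-punchOut± {v} avoid = trans (sym (map-∘ v)) (map-id-local (All.map (punchIn±-punchOut± j) avoid))

  map-∣∣-∷ʳ : ∀ v → map ∣_∣ (v ∷ʳ p) ≡ map ∣_∣ v ∷ʳ suc j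
  map-∣∣-∷ʳ v = trans (map-++ ∣_∣ v _) (cong (λ t → map ∣_∣ v ∷ʳ t) ∣p∣≡)

  signedPerm-extend : ∀ {m u} → suc j ℕ.≤ suc m → SignedPerm m u → SignedPerm (suc m) (map (punchIn± j) u ∷ʳ p)
  signedPerm-extend {m} {u} j≤m (len , range , uniq) =
    trans (length-∷ʳ (map _ u)) (cong suc (trans (length-map _ u) len)) ,
    All.∷ʳ⁺ (All.map⁺ (All.map (λ {x} → punchIn±-inRange j {x = x}) range)) p-range ,
    subst Unique (sym (trans (map-∣∣-∷ʳ (map _ u)) (cong (_∷ʳ suc j) (map-∣punchIn±∣ u))))
      (∷ʳ-unique⁺ (All.map⁺ {P = _≢ suc j} (All.universal (punchIn-≢ (suc j)) (map ∣_∣ u)))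
                  (Unique.map⁺ (punchIn-injective (suc j)) uniq))
    where
    p-range : InRange (suc m) p
    p-range = subst (λ a → 1 ℕ.≤ a × a ℕ.≤ suc m) (sym ∣p∣≡) (s≤s z≤n , j≤m)

  signedPerm-restrict : ∀ {m v} → suc j ℕ.≤ suc m → SignedPerm (suc m) (v ∷ʳ p) →
    SignedPerm m (map (punchOut± j) v) × All (λ y → ∣ y ∣ ≢ suc j) v
  signedPerm-restrict {m} {v} j≤m (len , range , uniq) =
    (trans (length-map _ v) (ℕP.suc-injective (trans (sym (length-∷ʳ v)) len)) ,
     All.map⁺ (All.zipWith (λ { {x} (r , a) → punchOut±-inRange j {x = x} j≤m a r }) (proj₁ (All.∷ʳ⁻ range) , avoid)) ,
     Unique.map⁻ (subst Unique ∣v∣≡ (proj₂ v-unique))) ,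
    avoid
    where
    v-unique = ∷ʳ-unique⁻ (map ∣_∣ v) (subst Unique (map-∣∣-∷ʳ v) uniq)
    avoid : All (λ y → ∣ y ∣ ≢ suc j) v
    avoid = All.map⁻ (proj₁ v-unique)
    ∣v∣≡ : map ∣_∣ v ≡ map (punchIn (suc j)) (map ∣_∣ (map (punchOut± j) v))
    ∣v∣≡ = trans (cong (map ∣_∣) (sym (map-punchIn±-punchOut± avoid))) (map-∣punchIn±∣ _)

  snakeShape-extend : ∀ x xs {q} → last (x ∷ xs) ≡ just q → SnakeShape (x ∷ xs) →
    Step (flips (length xs) true) (punchIn± j q) p → SnakeShape (map (punchIn± j) (x ∷ xs) ∷ʳ p)
  snakeShape-extend x xs {q} lq (neg , up) step =
    punchIn±-negative j neg ,
    alternating-∷ʳ⁺ true _ (map (punchIn± j) xs) (trans (last-map _ (x ∷ xs)) (cong (Maybe.map _) lq))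
      (alternating-map {Q = λ _ → ⊤} (λ _ _ → punchIn±-mono-< j) true (All.universal (λ _ → tt) (x ∷ xs)) up)
      (subst (λ l → Step (flips l true) (punchIn± j q) p) (sym (length-map _ xs)) step)

  snakeShape-restrict : ∀ x xs {q} → last (x ∷ xs) ≡ just q → All (λ y → ∣ y ∣ ≢ suc j) (x ∷ xs) →
    SnakeShape ((x ∷ xs) ∷ʳ p) → SnakeShape (map (punchOut± j) (x ∷ xs)) × Step (flips (length xs) true) q p
  snakeShape-restrict x xs lq avoid (neg , up) with alternating-∷ʳ⁻ true x xs lq up
  ... | up′ , step = (punchOut±-negative j neg , alternating-map (punchOut±-mono-< j) true avoid up′) , step

module SnakeRecurrence (k j : ℕ) (p : ℤ) (∣p∣≡ : ∣ p ∣ ≡ suc j) (j≤ : suc j ℕ.≤ suc (suc k))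
  {C : Pred ℤ 0ℓ} (C? : Decidable C) {b₀ : Bool} (parity : flips k true ≡ b₀)
  (C⇔ : ∀ q → C q ⇔ Step b₀ (punchIn± j q) p) where

  open Punch j p ∣p∣≡

  EndsIn : List ℤ → Set
  EndsIn u = Any (λ q → SnakeEndingAt (suc k) q u) (filter C? (letters (suc k)))

  endsIn? : Decidable EndsIn
  endsIn? u = any? (λ q → snakeEndingAt? (suc k) q u) (filter C? (letters (suc k)))

  extend : List ℤ → List ℤ
  extend u = map (punchIn± j) u ∷ʳ p

  extend-injective : Injective _≡_ _≡_ extend
  extend-injective e = map-injective (punchIn±-injective j) (∷ʳ-injectiveˡ _ _ e)

  C⇔Step : ∀ {l} → l ≡ k → ∀ q → C q ⇔ Step (flips l true) (punchIn± j q) p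
  C⇔Step refl rewrite parity = C⇔

  extend-snake : ∀ {u} → EndsIn u → SnakeEndingAt (suc (suc k)) p (extend u)
  extend-snake ends with find ends
  ... | q , q∈C , perm , shape , lq = go _ perm shape lq (proj₂ (∈-filter⁻ C? {xs = letters (suc k)} q∈C))
    where
    go : ∀ u → SignedPerm (suc k) u → SnakeShape u → last u ≡ just q → C q → SnakeEndingAt (suc (suc k)) p (extend u)
    go (x ∷ xs) perm@(len , _) shape lq cq =
      signedPerm-extend j≤ perm ,
      snakeShape-extend x xs lq shape (Equivalence.to (C⇔Step (ℕP.suc-injective len) q) cq) ,
      last-∷ʳ (map (punchIn± j) (x ∷ xs))

  restrict : ∀ {w} → SnakeEndingAt (suc (suc k)) p w → ∃ λ u → EndsIn u × extend u ≡ w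
  restrict {w} (perm , shape , lw) with last⇒∷ʳ w lw
  ... | [] , refl with () ← ℕP.suc-injective (proj₁ perm)
  ... | x ∷ xs , refl with signedPerm-restrict j≤ perm | last-∷ x xs
  ... | perm′ , avoid | q₀ , lq₀ with snakeShape-restrict x xs lq₀ avoid shape
  ... | shape′ , step =
    map (punchOut± j) (x ∷ xs) ,
    lose (∈-filter⁺ C? (∈-letters q-range) cq) (perm′ , shape′ , lq) ,
    cong (_∷ʳ p) (map-punchIn±-punchOut± avoid)
    where
    q = punchOut± j q₀
    lq : last (map (punchOut± j) (x ∷ xs)) ≡ just q
    lq = trans (last-map _ (x ∷ xs)) (cong (Maybe.map _) lq₀)
    q-range : InRange (suc k) q
    q-range = All-last (proj₁ (proj₂ perm′)) lq
    xs-len : length xs ≡ k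
    xs-len = ℕP.suc-injective (ℕP.suc-injective (trans (sym (length-∷ʳ (x ∷ xs))) (proj₁ perm)))
    cq : C q
    cq = Equivalence.from (C⇔Step xs-len q)
           (subst (λ y → Step _ y p) (sym (punchIn±-punchOut± j (All-last avoid lq₀))) step)

  recurrence : b (suc (suc k)) p ≡ sumOver C? (suc k) (b (suc k))
  recurrence = sym (trans count-by-last-letter count-by-extension)
    where
    count-by-last-letter : sumOver C? (suc k) (b (suc k)) ≡ length (filter endsIn? (words (suc k) (suc k)))
    count-by-last-letter =
      sum-length-filter-fibres (λ q → snakeEndingAt? (suc k) q)
        (λ (_ , _ , lq) (_ , _ , lq′) → just-injective (trans (sym lq) lq′))
        (Unique.filter⁺ C? (letters-unique (suc k))) (words (suc k) (suc k))
    count-by-extension :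
      length (filter endsIn? (words (suc k) (suc k))) ≡ length (filter (snakeEndingAt? (suc (suc k)) p) (words (suc (suc k)) (suc (suc k))))
    count-by-extension =
      length-filter-bijection endsIn? (snakeEndingAt? (suc (suc k)) p) extend-injective
        (words-unique (suc k) (suc k)) (words-unique (suc (suc k)) (suc (suc k)))
        (λ ends → ∈-words-signedPerm (proj₁ (proj₂ (proj₂ (find ends)))))
        (λ snake → ∈-words-signedPerm (proj₁ snake))
        extend-snake restrict

open SnakeRecurrence using (recurrence)

flips-even : ∀ k → suc (suc k) % 2 ≡ 0 → flips k true ≡ true
flips-even zero          _ = refl
flips-even (suc (suc k)) e = flips-even k e

flips-odd : ∀ k → suc (suc k) % 2 ≡ 1 → flips k true ≡ false
flips-odd (suc zero)    _ = refl
flips-odd (suc (suc k)) e = flips-odd k e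

proposition7p2 : (b 1 (- + 1) ≡ 1) × (b 1 (+ 1) ≡ 0) ×
    ((n : ℕ) → 2 ℕ.≤ n → (p : ℤ) → 1 ℕ.≤ ∣ p ∣ → ∣ p ∣ ℕ.≤ n →
    ((n % 2 ≡ 0 → p < + 0 →
    b n p ≡ sumOver (λ q → q ≤? p) (n ∸ 1) (b (n ∸ 1))) ×
    (n % 2 ≡ 0 → p > + 0 →
    b n p ≡ sumOver (λ q → q <? p) (n ∸ 1) (b (n ∸ 1))) ×
    (n % 2 ≡ 1 → p > + 0 →
    b n p ≡ sumOver (λ q → p ≤? q) (n ∸ 1) (b (n ∸ 1))) ×
    (n % 2 ≡ 1 → p < + 0 →
    b n p ≡ sumOver (λ q → p <? q) (n ∸ 1) (b (n ∸ 1)))))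
proposition7p2 = refl , refl , λ where
  (suc (suc k)) _ (+ suc j) _ j≤ →
    (λ _ → λ { (+<+ ()) }) ,
    (λ e _ → recurrence k j _ refl j≤ (_<? + suc j) (flips-even k e) (<-punchIn±-pos j)) ,
    (λ e _ → recurrence k j _ refl j≤ (+ suc j ≤?_) (flips-odd k e) (≤-punchIn±-pos j)) ,
    (λ _ → λ { (+<+ ()) })
  (suc (suc k)) _ -[1+ j ] _ j≤ →
    (λ e _ → recurrence k j _ refl j≤ (_≤? -[1+ j ]) (flips-even k e) (≤-punchIn±-neg j)) ,
    (λ _ ()) ,
    (λ _ ()) ,
    (λ e _ → recurrence k j _ refl j≤ (-[1+ j ] <?_) (flips-odd k e) (<-punchIn±-neg j))
  (suc (suc k)) _ (+ zero) () _
  (suc zero) (s≤s ())
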